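{- Let $\Psi$ be an arbitrary complex unit gain graph on $n$ vertices, let $A=A(\Psi)$ and let $z\in\mathbb{T}$. Then the gain graph $\hat{\Psi}$ with gain matrix \[A(\hat{\Psi})=\begin{bmatrix}A & zI\\ \bar{z}I & -A\end{bmatrix}\] is sign-symmetric.
   Context: $\mathbb{T}=\{z\in\mathbb{C}:|z|=1\}$. A complex unit gain graph $\Psi=(G,\psi)$ consists of a finite simple graph $G$ and a map $\psi$ assigning to each ordered pair $(u,v)$ with $uv$ an edge a value $\psi(uv)\in\mathbb{T}$, with $\psi(vu)=\psi(uv)^{ -1}$; its gain matrix $A(\Psi)$ is the Hermitian matrix with $A_{uv}=\psi(uv)$ for edges and $0$ otherwise; any Hermitian matrix with zero diagonal and entries in $\mathbb{T}\cup\{0\}$ is the gain matrix of a gain graph. The negation is $-\Psi=(G,-\psi)$. $\Psi\sim\Psi'$ (switching isomorphic) if $A(\Psi')$ is obtained from $A(\Psi)$ by $A\mapsto XAX^{ -1}$ with $X$ diagonal with entries in $\mathbb{T}$, possibly followed by taking the converse ($A\mapsto A^\top$) and/or relabeling vertices ($A\mapsto PAP^{ -1}$, $P$ a permutation matrix). $\Psi$ is sign-symmetric if $\Psi\sim-\Psi$. -}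

module Defs where

open import Data.Nat using (ℕ; _+_)
open import Data.Fin using (Fin; splitAt; _≟_)
open import Data.Fin.Permutation using (Permutation′; _⟨$⟩ʳ_)
open import Data.Maybe using (Maybe; just; nothing)
import Data.Maybe as Maybe
open import Data.Bool using (Bool; true; false; if_then_else_)
open import Data.Sum using (inj₁; inj₂)
open import Data.Product using (Σ; Σ-syntax; _×_)
open import Relation.Nullary using (¬_; does)
open import Relation.Binary.PropositionalEquality using (_≡_)
open import Algebra.Structures using (IsAbelianGroup)

-- An abstract model of the unit circle group 𝕋 = {z ∈ ℂ : |z| = 1}:
-- an abelian group (multiplication, 1, inverse = complex conjugate)
-- with a distinguished element m1 playing the role of -1
-- (m1 · m1 = 1, m1 ≠ 1); negation of a unit is multiplication by m1.
record UnitGroup : Set₁ where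
  field
    T       : Set
    _·_     : T → T → T
    one     : T
    inv     : T → T
    isAbGrp : IsAbelianGroup _≡_ _·_ one inv
    m1      : T
    m1²≡1   : m1 · m1 ≡ one
    m1≢1    : ¬ (m1 ≡ one)

module _ (U : UnitGroup) where
  open UnitGroup U

  -- n×n matrices with entries in 𝕋 ∪ {0}; `nothing` encodes 0.
  Mat : ℕ → Set
  Mat n = Fin n → Fin n → Maybe T

  -- Hermitian (A_uv = conj A_vu; conj = inverse on 𝕋) with zero diagonal:
  -- exactly the gain matrices of complex unit gain graphs on n vertices.
  IsGainMatrix : ∀ {n} → Mat n → Set
  IsGainMatrix {n} A =
    ((u v : Fin n) → A u v ≡ Maybe.map inv (A v u)) × ((u : Fin n) → A u u ≡ nothing)

  negM : ∀ {n} → Mat n → Mat n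
  negM A u v = Maybe.map (m1 ·_) (A u v)

  switch : ∀ {n} → (Fin n → T) → Mat n → Mat n
  switch x A u v = Maybe.map (λ a → (x u · a) · inv (x v)) (A u v)

  converse : ∀ {n} → Mat n → Mat n
  converse A u v = A v u

  relabel : ∀ {n} → Permutation′ n → Mat n → Mat n
  relabel σ A u v = A (σ ⟨$⟩ʳ u) (σ ⟨$⟩ʳ v)

  SwitchIso : ∀ {n} → Mat n → Mat n → Set
  SwitchIso {n} A B =
    Σ[ x ∈ (Fin n → T) ] Σ[ c ∈ Bool ] Σ[ σ ∈ Permutation′ n ]
      ((u v : Fin n) →
        B u v ≡ relabel σ (if c then converse (switch x A) else switch x A) u v)

  SignSymmetric : ∀ {n} → Mat n → Set
  SignSymmetric A = SwitchIso A (negM A)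

  -- the block matrix [[A, zI], [z̄I, -A]] on 2n vertices (first block = first n)
  hat : ∀ {n} → Mat n → T → Mat (n + n)
  hat {n} A z p q with splitAt n p | splitAt n q
  ... | inj₁ i | inj₁ j = A i j
  ... | inj₁ i | inj₂ j = if does (i ≟ j) then just z else nothing
  ... | inj₂ i | inj₁ j = if does (i ≟ j) then just (inv z) else nothing
  ... | inj₂ i | inj₂ j = negM A i j

-- Relabel by swapping the two halves of the vertex set and switch the second
-- half by c = −z². The swap exchanges the diagonal blocks A and −A, which is
-- the same as negating both, and switching leaves them alone because 𝕋 is
-- abelian. The off-diagonal blocks swap as well, and switching turns them into
-- the negated ones: c · z̄ = −z and z · c̄ = −z̄.
module Submission where

open import Defs
open import Data.Nat using (ℕ; _+_)
open import Data.Fin using (Fin; splitAt; _≟_)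
open import Data.Fin.Properties using (+↔⊎; splitAt-↑ˡ; splitAt-↑ʳ)
open import Data.Fin.Permutation using (Permutation′)
open import Data.Sum using (inj₁; inj₂; [_,_]′)
open import Data.Maybe using (Maybe; just; nothing)
import Data.Maybe as Maybe
open import Data.Maybe.Properties using (map-cong; map-∘)
open import Data.Bool using (Bool; true; false; if_then_else_)
open import Data.Product using (_,_)
open import Function using (_∘_; const)
open import Function.Construct.Composition using (_↔-∘_)
open import Function.Construct.Symmetry using (↔-sym)
open import Function.Related.TypeIsomorphisms using (⊎-comm)
open import Relation.Nullary using (does)
open import Relation.Binary.PropositionalEquality
open import Algebra.Bundles using (AbelianGroup)
open import Algebra.Structures using (IsAbelianGroup)
import Algebra.Properties.AbelianGroup as AbelianGroupProperties

swapHalves : ∀ n → Permutation′ (n + n)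
swapHalves n = ↔-sym +↔⊎ ↔-∘ (⊎-comm (Fin n) (Fin n) ↔-∘ +↔⊎)

module UnitGroupProperties (U : UnitGroup) where
  open UnitGroup U
  open IsAbelianGroup isAbGrp using (assoc; comm; identityˡ; identityʳ; inverseʳ)

  asAbelianGroup : AbelianGroup _ _
  asAbelianGroup = record { isAbelianGroup = isAbGrp }

  open AbelianGroupProperties asAbelianGroup
    using (inverseʳ-unique; ε⁻¹≈ε; ⁻¹-∙-comm)
  open ≡-Reasoning

  inv-m1 : inv m1 ≡ m1
  inv-m1 = sym (inverseʳ-unique m1 m1 m1²≡1)

  m1-involutive : ∀ a → m1 · (m1 · a) ≡ a
  m1-involutive a = begin
    m1 · (m1 · a) ≡⟨ assoc m1 m1 a ⟨
    (m1 · m1) · a ≡⟨ cong (_· a) m1²≡1 ⟩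
    one · a       ≡⟨ identityˡ a ⟩
    a             ∎

  conjugate-trivial : ∀ x a → (x · a) · inv x ≡ a
  conjugate-trivial x a = begin
    (x · a) · inv x ≡⟨ cong (_· inv x) (comm x a) ⟩
    (a · x) · inv x ≡⟨ assoc a x (inv x) ⟩
    a · (x · inv x) ≡⟨ cong (a ·_) (inverseʳ x) ⟩
    a · one         ≡⟨ identityʳ a ⟩
    a               ∎

  minusSquare : T → T
  minusSquare z = m1 · (z · z)

  minusSquare-·-inv : ∀ z → minusSquare z · inv z ≡ m1 · z
  minusSquare-·-inv z = begin
    (m1 · (z · z)) · inv z ≡⟨ assoc m1 (z · z) (inv z) ⟩
    m1 · ((z · z) · inv z) ≡⟨ cong (m1 ·_) (conjugate-trivial z z) ⟩
    m1 · z                 ∎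

  ·-inv-minusSquare : ∀ z → z · inv (minusSquare z) ≡ m1 · inv z
  ·-inv-minusSquare z = begin
    z · inv (m1 · (z · z))        ≡⟨ cong (z ·_) (⁻¹-∙-comm m1 (z · z)) ⟨
    z · (inv m1 · inv (z · z))    ≡⟨ cong (λ w → z · (w · inv (z · z))) inv-m1 ⟩
    z · (m1 · inv (z · z))        ≡⟨ cong (λ w → z · (m1 · w)) (⁻¹-∙-comm z z) ⟨
    z · (m1 · (inv z · inv z))    ≡⟨ cong (z ·_) (assoc m1 (inv z) (inv z)) ⟨
    z · ((m1 · inv z) · inv z)    ≡⟨ assoc z (m1 · inv z) (inv z) ⟨
    (z · (m1 · inv z)) · inv z    ≡⟨ conjugate-trivial z (m1 · inv z) ⟩
    m1 · inv z                    ∎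

  switchFrom-one : ∀ a y → (one · a) · inv y ≡ a · inv y
  switchFrom-one a y = cong (_· inv y) (identityˡ a)

  switchTo-one : ∀ x a → (x · a) · inv one ≡ x · a
  switchTo-one x a = trans (cong ((x · a) ·_) ε⁻¹≈ε) (identityʳ (x · a))

module _ (U : UnitGroup) (n : ℕ) (A : Mat U n) (z : UnitGroup.T U) where
  open UnitGroup U
  open UnitGroupProperties U

  halfSwitching : Fin (n + n) → T
  halfSwitching p = [ const one , const (minusSquare z) ]′ (splitAt n p)

  scalarBlock : Bool → T → Maybe T
  scalarBlock b w = if b then just w else nothing

  map-scalarBlock : ∀ {f : T → T} {w w′} b → f w ≡ w′ →
                    Maybe.map f (scalarBlock b w) ≡ scalarBlock b w′
  map-scalarBlock true  fw≡w′ = cong just fw≡w′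
  map-scalarBlock false _     = refl

  negate-hat-by-swap-and-switch : ∀ u v →
    negM U (hat U A z) u v ≡
    relabel U (swapHalves n) (switch U halfSwitching (hat U A z)) u v
  negate-hat-by-swap-and-switch u v with splitAt n u | splitAt n v
  ... | inj₁ i | inj₁ j rewrite splitAt-↑ʳ n n i | splitAt-↑ʳ n n j =
    sym (trans (sym (map-∘ (A i j)))
               (map-cong (conjugate-trivial (minusSquare z) ∘ (m1 ·_)) (A i j)))
  ... | inj₂ i | inj₂ j rewrite splitAt-↑ˡ n i n | splitAt-↑ˡ n j n =
    trans (sym (map-∘ (A i j)))
          (map-cong (λ a → trans (m1-involutive a) (sym (conjugate-trivial one a))) (A i j))
  ... | inj₁ i | inj₂ j rewrite splitAt-↑ʳ n n i | splitAt-↑ˡ n j n =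
    trans (map-scalarBlock (does (i ≟ j)) refl)
          (sym (map-scalarBlock (does (i ≟ j))
                 (trans (switchTo-one (minusSquare z) (inv z)) (minusSquare-·-inv z))))
  ... | inj₂ i | inj₁ j rewrite splitAt-↑ˡ n i n | splitAt-↑ʳ n n j =
    trans (map-scalarBlock (does (i ≟ j)) refl)
          (sym (map-scalarBlock (does (i ≟ j))
                 (trans (switchFrom-one z (minusSquare z)) (·-inv-minusSquare z))))

lemma4p2 : (U : UnitGroup) (n : ℕ) (A : Mat U n) → IsGainMatrix U A →
           (z : UnitGroup.T U) → SignSymmetric U (hat U A z)
lemma4p2 U n A _ z =
  halfSwitching U n A z , false , swapHalves n , negate-hat-by-swap-and-switch U n A z
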